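{- For any $k\in\mathcal{K}$, let $n=d_k^{\mathrm{ur}}$. Then $$\frac{k-2}{2}-\frac{(p-1)(\frac12 d_k^{\mathrm{new}}-1)+\theta_n}{2}\geq\frac{p-1}{p+1}k_\bullet-\begin{cases}2&\text{if } n \text{ is odd},\\ 1&\text{if } n\text{ is even}.\end{cases}$$
   Context: $p\geq 11$ is a prime, $a$ is an integer with $2\leq a\leq p-5$, $s\in\{0,\dots,p-2\}$. For an integer $n$, $\{n\}\in\{0,\dots,p-2\}$ is its residue modulo $p-1$. Put $\delta=\frac{1}{p-1}(\{a+s\}+s-\{a+2s\})\in\{0,1\}$; if $a+s<p-1$ put $t_1=s+\delta$, $t_2=a+s+\delta+2$; if $a+s\geq p-1$ put $t_1=\{a+s\}+\delta+1$, $t_2=s+\delta+1$. Let $k_\varepsilon=2+\{a+2s\}$ and $\mathcal{K}=\{k\geq 2: k\equiv k_\varepsilon\pmod{p-1}\}$; for $k\in\mathcal{K}$ write $k=k_\varepsilon+k_\bullet(p-1)$, and put $d_k^{\mathrm{Iw}}=2k_\bullet+2-2\delta$, $d_k^{\mathrm{ur}}=\lfloor\frac{k_\bullet-t_1}{p+1}\rfloor+\lfloor\frac{k_\bullet-t_2}{p+1}\rfloor+2$, $d_k^{\mathrm{new}}=d_k^{\mathrm{Iw}}-2d_k^{\mathrm{ur}}$. For an integer $n$ let $\beta_n=t_1$ if $n$ is even and $\beta_n=t_2-\frac{p+1}{2}$ if $n$ is odd, and $\theta_n=\beta_{n-1}-\beta_n+\frac{p+1}{2}$ (so $\theta_n=t_1-t_2+p+1$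 for $n$ odd and $\theta_n=t_2-t_1$ for $n$ even). -}

module Defs where

open import Data.Nat as ℕ using (ℕ; zero; suc; _+_; _*_; _∸_; _<?_)
open import Data.Nat.DivMod as ℕD using ()
open import Data.Integer as ℤ using (ℤ; +_; _/ℕ_; ∣_∣)
open import Data.Rational as ℚ using (ℚ)
open import Relation.Nullary.Decidable using (does)
open import Relation.Binary.PropositionalEquality using (_≡_)
open import Data.Product using (_×_)
open import Data.Bool using (Bool; true; false; if_then_else_)

-- Residue / quotient of a natural number modulo (p - 1).
-- (Guarded so that no NonZero instance is needed; for p ≥ 11 this is
--  exactly n % (p - 1), resp. n / (p - 1).)
modP : ℕ → ℕ → ℕ
modP p n with p ∸ 1
... | zero  = 0
... | suc m = n ℕ.% suc m

divP : ℕ → ℕ → ℕ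
divP p n with p ∸ 1
... | zero  = 0
... | suc m = n ℕ./ suc m

res : ℕ → ℕ → ℕ
res p n = modP p n

-- δ = ({a+s} + s - {a+2s}) / (p-1)   (numerator is ≥ 0 and divisible by p-1)
δ : ℕ → ℕ → ℕ → ℕ
δ p a s = divP p ((res p (a + s) + s) ∸ res p (a + 2 * s))

t₁ : ℕ → ℕ → ℕ → ℕ
t₁ p a s = if does (a + s <? p ∸ 1)
           then s + δ p a s
           else res p (a + s) + δ p a s + 1

t₂ : ℕ → ℕ → ℕ → ℕ
t₂ p a s = if does (a + s <? p ∸ 1)
           then a + s + δ p a s + 2
           else s + δ p a s + 1

kε : ℕ → ℕ → ℕ → ℕ
kε p a s = 2 + res p (a + 2 * s)

In𝒦 : ℕ → ℕ → ℕ → ℕ → Set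
In𝒦 p a s k = (2 ℕ.≤ k) × (res p k ≡ res p (kε p a s))

k• : ℕ → ℕ → ℕ → ℕ → ℕ
k• p a s k = divP p (k ∸ kε p a s)

dIw : ℕ → ℕ → ℕ → ℕ → ℤ
dIw p a s k = (+ (2 * k• p a s k + 2)) ℤ.- (+ (2 * δ p a s))

dUr : ℕ → ℕ → ℕ → ℕ → ℤ
dUr p a s k =
  ((+ k• p a s k ℤ.- + t₁ p a s) /ℕ suc p)
  ℤ.+ ((+ k• p a s k ℤ.- + t₂ p a s) /ℕ suc p)
  ℤ.+ + 2

dNew : ℕ → ℕ → ℕ → ℕ → ℤ
dNew p a s k = dIw p a s k ℤ.- (+ 2) ℤ.* dUr p a s k

toℚ : ℤ → ℚ
toℚ z = z ℚ./ 1

isEven : ℤ → Bool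
isEven n = does (∣ n ∣ ℕ.% 2 ℕ.≟ 0)

halfP1 : ℕ → ℚ
halfP1 p = + (suc p) ℚ./ 2

β : ℕ → ℕ → ℕ → ℤ → ℚ
β p a s n = if isEven n then toℚ (+ t₁ p a s) else (toℚ (+ t₂ p a s) ℚ.- halfP1 p)

θ : ℕ → ℕ → ℕ → ℤ → ℚ
θ p a s n = (β p a s (n ℤ.- + 1) ℚ.- β p a s n) ℚ.+ halfP1 p

-- Substituting k = 2 + {a+2s} + k•(p-1) and d^new = 2k• + 2 - 2δ - 2n makes four times the
-- left-hand side an integer, and since t₁ + t₂ = {a+2s} + δ(p+1) + 2 it collapses to
-- 4(T + (p-1)j - δ - c), where c is the constant subtracted on the right and (T, j) is (t₁, n/2)
-- for n even, (t₂, (n-1)/2) for n odd.  Here n = j₁ + j₂ with jᵢ = ⌊(k• - tᵢ)/(p+1)⌋ + 1, and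
-- 0 ≤ t₂ - t₁ < p + 1 forces j₁ - j₂ ∈ {0, 1}: the two cases are exactly the two parities.
-- What remains, (p-1)k• ≤ (p+1)(T - δ + (p-1)j), follows from k• < T + j(p+1) (the floor)
-- together with δ ≤ 1 and δ ≤ T.

module Submission where

open import Defs
open import Data.Nat as ℕ using (ℕ; _≤_; _∸_; suc)
open import Data.Nat.Primality using (Prime)
open import Data.Integer as ℤ using (+_)
open import Data.Rational as ℚ using (ℚ)
open import Data.Bool using (if_then_else_)

open import Data.Bool using (Bool; true; false; not)
open import Data.Nat using (zero; _+_; _*_; _<_; NonZero; _≤?_; _<?_; s≤s; s≤s⁻¹)
open import Data.Nat.Properties
open import Data.Nat.DivMod
open import Data.Nat.Divisibility using (_∣_; divides; ∣⇒≤)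
import Data.Nat.Coprimality as Coprime
import Data.Nat.Tactic.RingSolver as ℕ-Solver
open import Data.Integer using (ℤ; +0; +[1+_]; -[1+_]; +<+; _/ℕ_)
import Data.Integer.Properties as ℤP
open import Data.Integer.DivMod using (n<s[n/ℕd]*d; [n/ℕd]*d≤n)
import Data.Integer.Tactic.RingSolver as ℤ-Solver
open import Data.Rational using (mkℚ; ½; 1ℚ)
import Data.Rational.Properties as ℚP
open import Data.Rational.Solver using (module +-*-Solver)
open import Data.Rational.Unnormalised as ℚᵘ using (mkℚᵘ; *≡*)
import Data.Rational.Unnormalised.Properties as ℚᵘP
open import Data.List using (_∷_; [])
open import Data.Product using (_×_; _,_; proj₁; proj₂; ∃-syntax)
open import Data.Sum using (_⊎_; inj₁; inj₂)
open import Relation.Nullary using (¬_; yes; no; contradiction)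
open import Relation.Nullary.Decidable using (dec-true; dec-false)
open import Relation.Binary.PropositionalEquality

module _ (d : ℕ) .{{_ : NonZero d}} where

  %≡%⇒∣∸ : ∀ {k e} → k % d ≡ e % d → d ∣ k ∸ e
  %≡%⇒∣∸ {k} {e} k≡e = divides (k / d ∸ e / d) (begin
    k ∸ e                                     ≡⟨ cong₂ _∸_ (m≡m%n+[m/n]*n k d) (m≡m%n+[m/n]*n e d) ⟩
    (k % d + k / d * d) ∸ (e % d + e / d * d) ≡⟨ cong (λ r → (r + k / d * d) ∸ (e % d + e / d * d)) k≡e ⟩
    (e % d + k / d * d) ∸ (e % d + e / d * d) ≡⟨ [m+n]∸[m+o]≡n∸o (e % d) _ _ ⟩
    k / d * d ∸ e / d * d                     ≡⟨ *-distribʳ-∸ d (k / d) (e / d) ⟨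
    (k / d ∸ e / d) * d                       ∎)
    where open ≡-Reasoning

  %≡%⇒≤ : ∀ {k e} → k % d ≡ e % d → e < k + d → e ≤ k
  %≡%⇒≤ {k} {e} k≡e e<k+d with e ≤? k
  ... | yes e≤k = e≤k
  ... | no  e≰k = contradiction d≤e∸k (<⇒≱ (m<n+o⇒m∸n<o e k e<k+d))
    where
    d≤e∸k : d ≤ e ∸ k
    d≤e∸k = ∣⇒≤ {{ℕ.>-nonZero (m<n⇒0<n∸m (≰⇒> e≰k))}} (%≡%⇒∣∸ (sym k≡e))

  k≡e+[k∸e]/d*d : ∀ {k e} → e ≤ k → k % d ≡ e % d → k ≡ e + (k ∸ e) / d * d
  k≡e+[k∸e]/d*d {e = e} e≤k k≡e =
    trans (sym (m+[n∸m]≡n e≤k)) (cong (λ z → e + z) (sym (m/n*n≡m (%≡%⇒∣∸ k≡e))))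

  [x+s]%d≡[x%d+s]%d : ∀ x s → (x + s) % d ≡ (x % d + s) % d
  [x+s]%d≡[x%d+s]%d x s = begin
    (x + s) % d                   ≡⟨ %-distribˡ-+ x s d ⟩
    (x % d + s % d) % d           ≡⟨ cong (λ r → (r + s % d) % d) (m%n%n≡m%n x d) ⟨
    (x % d % d + s % d) % d       ≡⟨ %-distribˡ-+ (x % d) s d ⟨
    (x % d + s) % d               ∎
    where open ≡-Reasoning

  carry : ℕ → ℕ → ℕ
  carry x s = (x % d + s) / d

  [x%d+s]∸[x+s]%d≡carry*d : ∀ x s → (x % d + s) ∸ (x + s) % d ≡ carry x s * d
  [x%d+s]∸[x+s]%d≡carry*d x s = begin
    y ∸ (x + s) % d             ≡⟨ cong (y ∸_) ([x+s]%d≡[x%d+s]%d x s) ⟩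
    y ∸ y % d                   ≡⟨ cong (_∸ y % d) (m≡m%n+[m/n]*n y d) ⟩
    y % d + y / d * d ∸ y % d   ≡⟨ m+n∸m≡n (y % d) _ ⟩
    y / d * d                   ∎
    where
    open ≡-Reasoning
    y : ℕ
    y = x % d + s

  [x+s]%d+carry*d≡x%d+s : ∀ x s → (x + s) % d + carry x s * d ≡ x % d + s
  [x+s]%d+carry*d≡x%d+s x s =
    trans (cong (λ z → z + carry x s * d) ([x+s]%d≡[x%d+s]%d x s)) (sym (m≡m%n+[m/n]*n (x % d + s) d))

  carry≤1 : ∀ x {s} → s < d → carry x s ≤ 1
  carry≤1 x {s} s<d = s≤s⁻¹ (m<n*o⇒m/o<n (subst (x % d + s <_) d+d≡2*d (+-mono-< (m%n<n x d) s<d)))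
    where
    d+d≡2*d : d + d ≡ 2 * d
    d+d≡2*d = cong (λ z → d + z) (sym (+-identityʳ d))

  [y+D]/d≡y/d∨1+y/d : ∀ y {D} → D < d → (y + D) / d ≡ y / d ⊎ (y + D) / d ≡ suc (y / d)
  [y+D]/d≡y/d∨1+y/d y {D} D<d with m≤n⇒m<n∨m≡n upper
    where
    upper : (y + D) / d ≤ suc (y / d)
    upper = begin
      (y + D) / d       ≤⟨ /-monoˡ-≤ d (+-monoʳ-≤ y (<⇒≤ D<d)) ⟩
      (y + d) / d       ≡⟨ m/n≡1+[m∸n]/n (m≤n+m d y) ⟩
      suc ((y + d ∸ d) / d) ≡⟨ cong (λ z → suc (z / d)) (m+n∸n≡m y d) ⟩
      suc (y / d)       ∎
      where open ≤-Reasoning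
  ... | inj₁ below = inj₁ (≤-antisym (s≤s⁻¹ below) (/-monoˡ-≤ d (m≤m+n y D)))
  ... | inj₂ top   = inj₂ top

  y+t≡x+d⇒x<t+[y/d]*d : ∀ {x t y} → y + t ≡ x + d → x < t + y / d * d
  y+t≡x+d⇒x<t+[y/d]*d {x} {t} {y} y+t≡x+d = +-cancelʳ-< d x (t + y / d * d) (begin-strict
    x + d                 ≡⟨ y+t≡x+d ⟨
    y + t                 ≡⟨ cong (λ z → z + t) (m≡m%n+[m/n]*n y d) ⟩
    y % d + y / d * d + t <⟨ +-monoˡ-< t (+-monoˡ-< (y / d * d) (m%n<n y d)) ⟩
    d + y / d * d + t     ≡⟨ +-comm (d + y / d * d) t ⟩
    t + (d + y / d * d)   ≡⟨ cong (λ z → t + z) (+-comm d (y / d * d)) ⟩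
    t + (y / d * d + d)   ≡⟨ +-assoc t (y / d * d) d ⟨
    t + y / d * d + d     ∎)
    where open ≤-Reasoning

  /ℕ-unique : ∀ {i f r} → r < d → i ≡ + r ℤ.+ f ℤ.* + d → i /ℕ d ≡ f
  /ℕ-unique {i} {f} {r} r<d refl = ℤP.≤-antisym
    (<suc⇒≤ (ℤP.*-cancelʳ-<-nonNeg (+ d) (ℤP.≤-<-trans ([n/ℕd]*d≤n i d) i<[1+f]*d)))
    (<suc⇒≤ (ℤP.*-cancelʳ-<-nonNeg (+ d) (ℤP.≤-<-trans f*d≤i (n<s[n/ℕd]*d i d))))
    where
    <suc⇒≤ : ∀ {a b} → a ℤ.< ℤ.suc b → a ℤ.≤ b
    <suc⇒≤ {a} {b} a<1+b = subst (a ℤ.≤_) (ℤP.pred-suc b) (ℤP.i<j⇒i≤pred[j] a<1+b)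
    f*d≤i : f ℤ.* + d ℤ.≤ i
    f*d≤i = ℤP.i≤j+i (f ℤ.* + d) (+ r)
    i<[1+f]*d : i ℤ.< ℤ.suc f ℤ.* + d
    i<[1+f]*d = subst (i ℤ.<_) (sym (ℤP.suc-* f (+ d))) (ℤP.+-monoˡ-< (f ℤ.* + d) (+<+ r<d))

  y+t≡x+d⇒[x-t]/ℕd≡y/d-1 : ∀ {x t y} → y + t ≡ x + d → (+ x ℤ.- + t) /ℕ d ≡ + (y / d) ℤ.- + 1
  y+t≡x+d⇒[x-t]/ℕd≡y/d-1 {x} {t} {y} y+t≡x+d = /ℕ-unique (m%n<n y d) (begin
    + x ℤ.- + t                                     ≡⟨ shift (+ x) (+ t) (+ d) ⟩
    (+ x ℤ.+ + d) ℤ.- (+ t ℤ.+ + d)                 ≡⟨ cong (λ z → + z ℤ.- (+ t ℤ.+ + d)) y+t≡x+d ⟨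
    (+ y ℤ.+ + t) ℤ.- (+ t ℤ.+ + d)                 ≡⟨ unshift (+ y) (+ d) (+ t) ⟩
    + y ℤ.- + d                                     ≡⟨ cong (ℤ._- + d) +y≡ ⟩
    + (y % d) ℤ.+ + (y / d) ℤ.* + d ℤ.- + d         ≡⟨ regroup (+ (y % d)) (+ (y / d)) (+ d) ⟩
    + (y % d) ℤ.+ (+ (y / d) ℤ.- + 1) ℤ.* + d       ∎)
    where
    open ≡-Reasoning
    shift : ∀ a b c → a ℤ.- b ≡ (a ℤ.+ c) ℤ.- (b ℤ.+ c)
    shift = ℤ-Solver.solve-∀
    unshift : ∀ a b c → (a ℤ.+ c) ℤ.- (c ℤ.+ b) ≡ a ℤ.- b
    unshift = ℤ-Solver.solve-∀
    regroup : ∀ r j e → r ℤ.+ j ℤ.* e ℤ.- e ≡ r ℤ.+ (j ℤ.- + 1) ℤ.* e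
    regroup = ℤ-Solver.solve-∀
    +y≡ : + y ≡ + (y % d) ℤ.+ + (y / d) ℤ.* + d
    +y≡ = trans (cong +_ (m≡m%n+[m/n]*n y d)) (cong (λ z → + (y % d) ℤ.+ z) (ℤP.pos-* (y / d) d))

-- In this normal form ℚ's _+_, _*_ and -_ on integers reduce to the integer operations over 1.
toℚ≡mkℚ : ∀ z → toℚ z ≡ mkℚ z 0 (Coprime.sym (Coprime.1-coprimeTo ℤ.∣ z ∣))
toℚ≡mkℚ z = ℚP.↥p/↧p≡p (mkℚ z 0 (Coprime.sym (Coprime.1-coprimeTo ℤ.∣ z ∣)))

toℚ-+ : ∀ i j → toℚ (i ℤ.+ j) ≡ toℚ i ℚ.+ toℚ j
toℚ-+ i j rewrite toℚ≡mkℚ i | toℚ≡mkℚ j =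
  cong₂ (λ x y → toℚ (x ℤ.+ y)) (sym (ℤP.*-identityʳ i)) (sym (ℤP.*-identityʳ j))

toℚ-* : ∀ i j → toℚ (i ℤ.* j) ≡ toℚ i ℚ.* toℚ j
toℚ-* i j rewrite toℚ≡mkℚ i | toℚ≡mkℚ j = refl

toℚ-neg : ∀ i → toℚ (ℤ.- i) ≡ ℚ.- toℚ i
toℚ-neg i rewrite toℚ≡mkℚ i | toℚ≡mkℚ (ℤ.- i) with i
... | +0       = refl
... | +[1+ n ] = refl
... | -[1+ n ] = refl

toℚ-- : ∀ i j → toℚ (i ℤ.- j) ≡ toℚ i ℚ.- toℚ j
toℚ-- i j = trans (toℚ-+ i (ℤ.- j)) (cong (toℚ i ℚ.+_) (toℚ-neg j))

toℚ-mono-≤ : ∀ {i j} → i ℤ.≤ j → toℚ i ℚ.≤ toℚ j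
toℚ-mono-≤ {i} {j} i≤j rewrite toℚ≡mkℚ i | toℚ≡mkℚ j = ℚ.*≤* (ℤP.*-monoʳ-≤-nonNeg (+ 1) i≤j)

[i/n]*n≡i : ∀ i n → (i ℚ./ suc n) ℚ.* toℚ (+ suc n) ≡ toℚ i
[i/n]*n≡i i n = ℚP.toℚᵘ-injective (begin
  ℚ.toℚᵘ ((i ℚ./ suc n) ℚ.* toℚ (+ suc n))           ≈⟨ ℚP.toℚᵘ-homo-* (i ℚ./ suc n) (toℚ (+ suc n)) ⟩
  ℚ.toℚᵘ (i ℚ./ suc n) ℚᵘ.* ℚ.toℚᵘ (toℚ (+ suc n))   ≈⟨ ℚᵘP.*-cong (unnormalise i n) (unnormalise (+ suc n) 0) ⟩
  mkℚᵘ i n ℚᵘ.* mkℚᵘ (+ suc n) 0                      ≈⟨ *≡* cancel ⟩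
  mkℚᵘ i 0                                            ≈⟨ unnormalise i 0 ⟨
  ℚ.toℚᵘ (toℚ i)                                      ∎)
  where
  open ℚᵘP.≃-Reasoning
  unnormalise : ∀ j d → ℚ.toℚᵘ (j ℚ./ suc d) ℚᵘ.≃ mkℚᵘ j d
  unnormalise j d = ℚP.toℚᵘ-fromℚᵘ (mkℚᵘ j d)
  cancel : (i ℤ.* + suc n) ℤ.* + 1 ≡ i ℤ.* + suc (n * 1)
  cancel = trans (ℤP.*-identityʳ _) (cong (λ x → i ℤ.* + suc x) (sym (*-identityʳ n)))

-- Four times the left-hand side is the image in ℚ of the integer 2(k - 2) - m(dnew - 2) - 2Θ.
clear-denominators : ∀ (m k kb x : ℕ) (dnew Θ C : ℤ) {θ c : ℚ} → θ ≡ toℚ Θ → c ≡ toℚ C →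
  + 2 ℤ.* (+ k ℤ.- + 2) ℤ.- + m ℤ.* (dnew ℤ.- + 2) ℤ.- + 2 ℤ.* Θ ≡ + 4 ℤ.* (+ x ℤ.- C) →
  m * kb ≤ x * (2 + m) →
  ((toℚ (+ k) ℚ.- toℚ (+ 2)) ℚ.* ½) ℚ.- (((toℚ (+ m) ℚ.* ((toℚ dnew ℚ.* ½) ℚ.- 1ℚ)) ℚ.+ θ) ℚ.* ½)
    ℚ.≥ ((+ m ℚ./ (2 + m)) ℚ.* toℚ (+ kb)) ℚ.- c
clear-denominators m k kb x dnew Θ C refl refl integer-identity mkb≤xq = begin
  W ℚ.* toℚ (+ kb) ℚ.- toℚ C   ≤⟨ ℚP.+-monoˡ-≤ (ℚ.- toℚ C) Wkb≤x ⟩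
  toℚ (+ x) ℚ.- toℚ C          ≡⟨ lhs≡x-C ⟨
  _                            ∎
  where
  open ℚP.≤-Reasoning
  open +-*-Solver using (solve; _:+_; _:-_; _:*_; con; _:=_)
  W Q 2′ A′ B′ : ℚ
  W = + m ℚ./ (2 + m)
  Q = toℚ (+ (2 + m))
  2′ = toℚ (+ 2)
  A′ = 2′ ℚ.* (toℚ (+ k) ℚ.- 2′)
  B′ = toℚ (+ m) ℚ.* (toℚ dnew ℚ.- 2′)
  A B : ℤ
  A = + 2 ℤ.* (+ k ℤ.- + 2)
  B = + m ℤ.* (dnew ℤ.- + 2)

  toℚ-A : toℚ A ≡ A′
  toℚ-A = trans (toℚ-* (+ 2) (+ k ℤ.- + 2)) (cong (2′ ℚ.*_) (toℚ-- (+ k) (+ 2)))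

  toℚ-B : toℚ B ≡ B′
  toℚ-B = trans (toℚ-* (+ m) (dnew ℤ.- + 2)) (cong (toℚ (+ m) ℚ.*_) (toℚ-- dnew (+ 2)))

  toℚ-A-B-2Θ : toℚ (A ℤ.- B ℤ.- + 2 ℤ.* Θ) ≡ A′ ℚ.- B′ ℚ.- 2′ ℚ.* toℚ Θ
  toℚ-A-B-2Θ = begin-equality
    toℚ (A ℤ.- B ℤ.- + 2 ℤ.* Θ)           ≡⟨ toℚ-- (A ℤ.- B) (+ 2 ℤ.* Θ) ⟩
    toℚ (A ℤ.- B) ℚ.- toℚ (+ 2 ℤ.* Θ)     ≡⟨ cong₂ ℚ._-_ (toℚ-- A B) (toℚ-* (+ 2) Θ) ⟩
    toℚ A ℚ.- toℚ B ℚ.- 2′ ℚ.* toℚ Θ      ≡⟨ cong₂ (λ a b → a ℚ.- b ℚ.- _) toℚ-A toℚ-B ⟩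
    A′ ℚ.- B′ ℚ.- 2′ ℚ.* toℚ Θ            ∎

  toℚ-4[x-C] : toℚ (+ 4 ℤ.* (+ x ℤ.- C)) ≡ toℚ (+ 4) ℚ.* (toℚ (+ x) ℚ.- toℚ C)
  toℚ-4[x-C] = trans (toℚ-* (+ 4) (+ x ℤ.- C)) (cong (toℚ (+ 4) ℚ.*_) (toℚ-- (+ x) C))

  lhs-in-quarters : ∀ k d m θ →
    ((k ℚ.- 2′) ℚ.* ½) ℚ.- (((m ℚ.* ((d ℚ.* ½) ℚ.- 1ℚ)) ℚ.+ θ) ℚ.* ½)
      ≡ (2′ ℚ.* (k ℚ.- 2′) ℚ.- m ℚ.* (d ℚ.- 2′) ℚ.- 2′ ℚ.* θ) ℚ.* (½ ℚ.* ½)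
  lhs-in-quarters = solve 4 (λ k d m θ →
    ((k :- con 2′) :* con ½) :- (((m :* ((d :* con ½) :- con 1ℚ)) :+ θ) :* con ½)
      := (con 2′ :* (k :- con 2′) :- m :* (d :- con 2′) :- con 2′ :* θ) :* (con ½ :* con ½)) refl

  quarter-of-four : ∀ y c → (toℚ (+ 4) ℚ.* (y ℚ.- c)) ℚ.* (½ ℚ.* ½) ≡ y ℚ.- c
  quarter-of-four = solve 2 (λ y c → (con (toℚ (+ 4)) :* (y :- c)) :* (con ½ :* con ½) := y :- c) refl

  lhs≡x-C :
    ((toℚ (+ k) ℚ.- 2′) ℚ.* ½) ℚ.- (((toℚ (+ m) ℚ.* ((toℚ dnew ℚ.* ½) ℚ.- 1ℚ)) ℚ.+ toℚ Θ) ℚ.* ½)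
      ≡ toℚ (+ x) ℚ.- toℚ C
  lhs≡x-C = begin-equality
    _ ≡⟨ lhs-in-quarters (toℚ (+ k)) (toℚ dnew) (toℚ (+ m)) (toℚ Θ) ⟩
    _ ≡⟨ cong (ℚ._* (½ ℚ.* ½)) (trans (sym toℚ-A-B-2Θ) (trans (cong toℚ integer-identity) toℚ-4[x-C])) ⟩
    _ ≡⟨ quarter-of-four (toℚ (+ x)) (toℚ C) ⟩
    _ ∎

  swap-right : ∀ w b q → (w ℚ.* b) ℚ.* q ≡ (w ℚ.* q) ℚ.* b
  swap-right = solve 3 (λ w b q → (w :* b) :* q := (w :* q) :* b) refl

  Wkb≤x : W ℚ.* toℚ (+ kb) ℚ.≤ toℚ (+ x)
  Wkb≤x = ℚP.*-cancelʳ-≤-pos Q {{ℚP.normalize-pos (2 + m) 1}} (begin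
    (W ℚ.* toℚ (+ kb)) ℚ.* Q   ≡⟨ swap-right W (toℚ (+ kb)) Q ⟩
    (W ℚ.* Q) ℚ.* toℚ (+ kb)   ≡⟨ cong (ℚ._* toℚ (+ kb)) ([i/n]*n≡i (+ m) (suc m)) ⟩
    toℚ (+ m) ℚ.* toℚ (+ kb)   ≡⟨ trans (cong toℚ (ℤP.pos-* m kb)) (toℚ-* (+ m) (+ kb)) ⟨
    toℚ (+ (m * kb))           ≤⟨ toℚ-mono-≤ (ℤ.+≤+ mkb≤xq) ⟩
    toℚ (+ (x * (2 + m)))      ≡⟨ trans (cong toℚ (ℤP.pos-* x (2 + m))) (toℚ-* (+ x) (+ (2 + m))) ⟩
    toℚ (+ x) ℚ.* Q            ∎)

isEven-suc : ∀ n → isEven (+ suc n) ≡ not (isEven (+ n))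
isEven-suc zero          = refl
isEven-suc (suc zero)    = refl
isEven-suc (suc (suc n)) = isEven-suc n

isEven-double : ∀ j → isEven (+ (j + j)) ≡ true
isEven-double zero    = refl
isEven-double (suc j) = trans (cong (λ n → isEven (+ suc n)) (+-suc j j)) (isEven-double j)

isEven-double+1 : ∀ j → isEven (+ suc (j + j)) ≡ false
isEven-double+1 j = trans (isEven-suc (j + j)) (cong not (isEven-double j))

isEven-double-1 : ∀ j → isEven (+ (j + j) ℤ.- + 1) ≡ false
isEven-double-1 zero    = refl
isEven-double-1 (suc j) = trans (cong (λ n → isEven (+ n)) (+-suc j j)) (isEven-double+1 j)

module _ (p a s : ℕ) where
  private
    h T₁ T₂ : ℚ
    h = halfP1 p
    T₁ = toℚ (+ t₁ p a s)
    T₂ = toℚ (+ t₂ p a s)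
    βat : Bool → ℚ
    βat b = if b then T₁ else T₂ ℚ.- h

  θ-even : ∀ j → θ p a s (+ (j + j)) ≡ toℚ (+ t₂ p a s ℤ.- + t₁ p a s)
  θ-even j = begin
    θ p a s (+ (j + j))          ≡⟨ cong₂ (λ b₀ b₁ → (βat b₀ ℚ.- βat b₁) ℚ.+ h)
                                      (isEven-double-1 j) (isEven-double j) ⟩
    ((T₂ ℚ.- h) ℚ.- T₁) ℚ.+ h    ≡⟨ cancel T₁ T₂ h ⟩
    T₂ ℚ.- T₁                    ≡⟨ toℚ-- (+ t₂ p a s) (+ t₁ p a s) ⟨
    toℚ (+ t₂ p a s ℤ.- + t₁ p a s) ∎
    where
    open ≡-Reasoning
    open +-*-Solver using (solve; _:+_; _:-_; _:=_)
    cancel : ∀ x y z → ((y ℚ.- z) ℚ.- x) ℚ.+ z ≡ y ℚ.- x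
    cancel = solve 3 (λ x y z → ((y :- z) :- x) :+ z := y :- x) refl

  θ-odd : ∀ j → θ p a s (+ suc (j + j)) ≡ toℚ (+ t₁ p a s ℤ.- + t₂ p a s ℤ.+ + suc p)
  θ-odd j = begin
    θ p a s (+ suc (j + j))      ≡⟨ cong₂ (λ b₀ b₁ → (βat b₀ ℚ.- βat b₁) ℚ.+ h)
                                      (isEven-double j) (isEven-double+1 j) ⟩
    (T₁ ℚ.- (T₂ ℚ.- h)) ℚ.+ h    ≡⟨ double T₁ T₂ h ⟩
    T₁ ℚ.- T₂ ℚ.+ h ℚ.* toℚ (+ 2) ≡⟨ cong (T₁ ℚ.- T₂ ℚ.+_) ([i/n]*n≡i (+ suc p) 1) ⟩
    T₁ ℚ.- T₂ ℚ.+ toℚ (+ suc p)  ≡⟨ cong (ℚ._+ toℚ (+ suc p)) (toℚ-- (+ t₁ p a s) (+ t₂ p a s)) ⟨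
    toℚ (+ t₁ p a s ℤ.- + t₂ p a s) ℚ.+ toℚ (+ suc p) ≡⟨ toℚ-+ (+ t₁ p a s ℤ.- + t₂ p a s) (+ suc p) ⟨
    toℚ (+ t₁ p a s ℤ.- + t₂ p a s ℤ.+ + suc p) ∎
    where
    open ≡-Reasoning
    open +-*-Solver using (solve; _:+_; _:-_; _:*_; con; _:=_)
    double : ∀ x y z → (x ℚ.- (y ℚ.- z)) ℚ.+ z ≡ x ℚ.- y ℚ.+ z ℚ.* toℚ (+ 2)
    double = solve 3 (λ x y z → (x :- (y :- z)) :+ z := x :- y :+ z :* con (toℚ (+ 2))) refl

quadrupled-lhs-even : ∀ {K DN ρ} (M KB Δ T₁ T₂ J : ℤ) →
  K ≡ + 2 ℤ.+ ρ ℤ.+ KB ℤ.* M →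
  DN ≡ + 2 ℤ.* KB ℤ.+ + 2 ℤ.- + 2 ℤ.* Δ ℤ.- + 2 ℤ.* (J ℤ.+ J) →
  ρ ≡ T₁ ℤ.+ T₂ ℤ.- (Δ ℤ.* (+ 2 ℤ.+ M) ℤ.+ + 2) →
  + 2 ℤ.* (K ℤ.- + 2) ℤ.- M ℤ.* (DN ℤ.- + 2) ℤ.- + 2 ℤ.* (T₂ ℤ.- T₁)
    ≡ + 4 ℤ.* (T₁ ℤ.- Δ ℤ.+ M ℤ.* J ℤ.- + 1)
quadrupled-lhs-even M KB Δ T₁ T₂ J refl refl refl = ℤ-Solver.solve (M ∷ KB ∷ Δ ∷ T₁ ∷ T₂ ∷ J ∷ [])

quadrupled-lhs-odd : ∀ {K DN ρ} (M KB Δ T₁ T₂ J : ℤ) →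
  K ≡ + 2 ℤ.+ ρ ℤ.+ KB ℤ.* M →
  DN ≡ + 2 ℤ.* KB ℤ.+ + 2 ℤ.- + 2 ℤ.* Δ ℤ.- + 2 ℤ.* ((+ 1 ℤ.+ J) ℤ.+ J) →
  ρ ≡ T₁ ℤ.+ T₂ ℤ.- (Δ ℤ.* (+ 2 ℤ.+ M) ℤ.+ + 2) →
  + 2 ℤ.* (K ℤ.- + 2) ℤ.- M ℤ.* (DN ℤ.- + 2) ℤ.- + 2 ℤ.* (T₁ ℤ.- T₂ ℤ.+ (+ 2 ℤ.+ M))
    ≡ + 4 ℤ.* (T₂ ℤ.- Δ ℤ.+ M ℤ.* J ℤ.- + 2)
quadrupled-lhs-odd M KB Δ T₁ T₂ J refl refl refl = ℤ-Solver.solve (M ∷ KB ∷ Δ ∷ T₁ ∷ T₂ ∷ J ∷ [])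

scaled-floor-bound : ∀ {m kb d T j} → d ≤ 1 → d ≤ T → kb < T + j * (2 + m) →
                     m * kb ≤ (T ∸ d + m * j) * (2 + m)
scaled-floor-bound {m} {kb} {d} {T} {j} d≤1 d≤T kb<T+jq = +-cancelʳ-≤ m (m * kb) _ (begin
  m * kb + m                            ≡⟨ trans (+-comm (m * kb) m) (sym (*-suc m kb)) ⟩
  m * suc kb                            ≤⟨ *-monoʳ-≤ m kb<T+jq ⟩
  m * (T + j * (2 + m))                 ≡⟨ cong (λ t → m * (t + j * (2 + m))) (m+[n∸m]≡n d≤T) ⟨
  m * (d + e + j * (2 + m))             ≤⟨ *-monoʳ-≤ m (+-monoˡ-≤ (j * (2 + m)) (+-monoˡ-≤ e d≤1)) ⟩
  m * (1 + e + j * (2 + m))             ≡⟨ expand m e j ⟩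
  m * e + m * j * (2 + m) + m           ≤⟨ +-monoˡ-≤ m (+-monoˡ-≤ _ (*-monoˡ-≤ e (m≤n+m m 2))) ⟩
  (2 + m) * e + m * j * (2 + m) + m     ≡⟨ collect m e j ⟩
  (e + m * j) * (2 + m) + m             ∎)
  where
  open ≤-Reasoning
  e : ℕ
  e = T ∸ d
  expand : ∀ m e j → m * (1 + e + j * (2 + m)) ≡ m * e + m * j * (2 + m) + m
  expand = ℕ-Solver.solve-∀
  collect : ∀ m e j → (2 + m) * e + m * j * (2 + m) + m ≡ (e + m * j) * (2 + m) + m
  collect = ℕ-Solver.solve-∀

-- The prime is p = μ + 2, so that p - 1 = suc μ is a successor and res, δ and k• compute to
-- _%_ and _/_ by it.
module Estimate (μ a s k : ℕ) (a≤m : a ≤ suc μ) (s<m : s < suc μ) (k∈𝒦 : In𝒦 (suc (suc μ)) a s k)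
  where

  m p q ρ r δₚ κ T₁ T₂ : ℕ
  m = suc μ
  p = suc m
  q = suc p
  ρ = res p (a + 2 * s)
  r = res p (a + s)
  δₚ = δ p a s
  κ = k• p a s k
  T₁ = t₁ p a s
  T₂ = t₂ p a s

  a+2s≡a+s+s : a + 2 * s ≡ a + s + s
  a+2s≡a+s+s = ℕ-Solver.solve (a ∷ s ∷ [])

  δ≡carry : δₚ ≡ carry m (a + s) s
  δ≡carry = begin
    (r + s ∸ (a + 2 * s) % m) / m   ≡⟨ cong (λ x → (r + s ∸ x % m) / m) a+2s≡a+s+s ⟩
    (r + s ∸ (a + s + s) % m) / m   ≡⟨ cong (_/ m) ([x%d+s]∸[x+s]%d≡carry*d m (a + s) s) ⟩
    carry m (a + s) s * m / m       ≡⟨ m*n/n≡m (carry m (a + s) s) m ⟩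
    carry m (a + s) s               ∎
    where open ≡-Reasoning

  ρ+δm≡r+s : ρ + δₚ * m ≡ r + s
  ρ+δm≡r+s = begin
    (a + 2 * s) % m + δₚ * m                ≡⟨ cong₂ (λ x y → x % m + y * m) a+2s≡a+s+s δ≡carry ⟩
    (a + s + s) % m + carry m (a + s) s * m ≡⟨ [x+s]%d+carry*d≡x%d+s m (a + s) s ⟩
    r + s                                   ∎
    where open ≡-Reasoning

  δ≤1 : δₚ ≤ 1
  δ≤1 = subst (_≤ 1) (sym δ≡carry) (carry≤1 m (a + s) s<m)

  k≡2+ρ+κm : k ≡ 2 + ρ + κ * m
  k≡2+ρ+κm = k≡e+[k∸e]/d*d m kε≤k (proj₂ k∈𝒦)
    where
    kε≤k : 2 + ρ ≤ k
    kε≤k = %≡%⇒≤ m (proj₂ k∈𝒦) (+-mono-≤-< (proj₁ k∈𝒦) (m%n<n (a + 2 * s) m))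

  t-small : a + s < m → T₁ ≡ s + δₚ × T₂ ≡ a + s + δₚ + 2
  t-small h = cong (λ b → if b then s + δₚ else r + δₚ + 1) (dec-true (a + s <? m) h)
            , cong (λ b → if b then a + s + δₚ + 2 else s + δₚ + 1) (dec-true (a + s <? m) h)

  t-large : ¬ (a + s < m) → T₁ ≡ r + δₚ + 1 × T₂ ≡ s + δₚ + 1
  t-large h = cong (λ b → if b then s + δₚ else r + δₚ + 1) (dec-false (a + s <? m) h)
            , cong (λ b → if b then a + s + δₚ + 2 else s + δₚ + 1) (dec-false (a + s <? m) h)

  r+m≡a+s : ¬ (a + s < m) → r + m ≡ a + s
  r+m≡a+s h = trans (cong (_+ m) r≡y) y+m≡a+s
    where
    y : ℕ
    y = a + s ∸ m
    y+m≡a+s : y + m ≡ a + s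
    y+m≡a+s = m∸n+n≡m (≮⇒≥ h)
    y<m : y < m
    y<m = +-cancelʳ-< m y m (subst (_< m + m) (sym y+m≡a+s) (+-mono-≤-< a≤m s<m))
    r≡y : r ≡ y
    r≡y = trans (cong (_% m) (sym y+m≡a+s)) (trans ([m+n]%n≡m%n y m) (m<n⇒m%n≡m y<m))

  t₁+t₂≡r+s+2δ+2 : T₁ + T₂ ≡ r + s + 2 * δₚ + 2
  t₁+t₂≡r+s+2δ+2 with a + s <? m
  ... | yes h = begin
    T₁ + T₂                      ≡⟨ cong₂ _+_ (proj₁ (t-small h)) (proj₂ (t-small h)) ⟩
    s + δₚ + (a + s + δₚ + 2)    ≡⟨ small a s δₚ ⟩
    a + s + s + 2 * δₚ + 2       ≡⟨ cong (λ x → x + s + 2 * δₚ + 2) (m<n⇒m%n≡m h) ⟨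
    r + s + 2 * δₚ + 2           ∎
    where
    open ≡-Reasoning
    small : ∀ a s d → s + d + (a + s + d + 2) ≡ a + s + s + 2 * d + 2
    small = ℕ-Solver.solve-∀
  ... | no h = trans (cong₂ _+_ (proj₁ (t-large h)) (proj₂ (t-large h))) (large r s δₚ)
    where
    large : ∀ r s d → r + d + 1 + (s + d + 1) ≡ r + s + 2 * d + 2
    large = ℕ-Solver.solve-∀

  δ≤t₁ : δₚ ≤ T₁
  δ≤t₁ with a + s <? m
  ... | yes h = subst (δₚ ≤_) (sym (proj₁ (t-small h))) (m≤n+m δₚ s)
  ... | no h  = subst (δₚ ≤_) (sym (proj₁ (t-large h))) (≤-trans (m≤n+m δₚ r) (m≤m+n _ 1))

  t₂≤q : T₂ ≤ q
  t₂≤q with a + s <? m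
  ... | yes h = subst (_≤ q) (sym (proj₂ (t-small h))) (begin
    a + s + δₚ + 2      ≤⟨ +-monoˡ-≤ 2 (+-monoʳ-≤ (a + s) δ≤1) ⟩
    a + s + 1 + 2       ≡⟨ +-comm (a + s + 1) 2 ⟩
    2 + (a + s + 1)     ≡⟨ cong (_+_ 2) (+-comm (a + s) 1) ⟩
    2 + suc (a + s)     ≤⟨ +-monoʳ-≤ 2 h ⟩
    q                   ∎)
    where open ≤-Reasoning
  ... | no h = subst (_≤ q) (sym (proj₂ (t-large h))) (begin
    s + δₚ + 1          ≤⟨ +-monoˡ-≤ 1 (+-monoʳ-≤ s δ≤1) ⟩
    s + 1 + 1           ≡⟨ +-comm (s + 1) 1 ⟩
    suc (s + 1)         ≡⟨ cong suc (+-comm s 1) ⟩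
    suc (suc s)         ≤⟨ s≤s (s≤s (<⇒≤ s<m)) ⟩
    q                   ∎)
    where open ≤-Reasoning

  t-gap : ∃[ D ] T₂ ≡ T₁ + D × D < q
  t-gap with a + s <? m
  ... | yes h = a + 2 , gap , a+2<q
    where
    gap : T₂ ≡ T₁ + (a + 2)
    gap = trans (proj₂ (t-small h)) (trans (shift a s δₚ) (cong (_+ (a + 2)) (sym (proj₁ (t-small h)))))
      where
      shift : ∀ a s d → a + s + d + 2 ≡ s + d + (a + 2)
      shift = ℕ-Solver.solve-∀
    a+2<q : a + 2 < q
    a+2<q = subst (_< q) (+-comm 2 a) (+-monoʳ-< 2 (≤-<-trans (m≤m+n a s) h))
  ... | no h = m ∸ a , gap , s≤s (≤-trans (m∸n≤m m a) (n≤1+n m))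
    where
    r+[m∸a]≡s : r + (m ∸ a) ≡ s
    r+[m∸a]≡s = +-cancelʳ-≡ a (r + (m ∸ a)) s (begin
      r + (m ∸ a) + a     ≡⟨ +-assoc r (m ∸ a) a ⟩
      r + (m ∸ a + a)     ≡⟨ cong (_+_ r) (m∸n+n≡m a≤m) ⟩
      r + m               ≡⟨ r+m≡a+s h ⟩
      a + s               ≡⟨ +-comm a s ⟩
      s + a               ∎)
      where open ≡-Reasoning
    gap : T₂ ≡ T₁ + (m ∸ a)
    gap = begin
      T₂                     ≡⟨ proj₂ (t-large h) ⟩
      s + δₚ + 1             ≡⟨ cong (λ x → x + δₚ + 1) r+[m∸a]≡s ⟨
      r + (m ∸ a) + δₚ + 1   ≡⟨ shift r (m ∸ a) δₚ ⟩
      r + δₚ + 1 + (m ∸ a)   ≡⟨ cong (_+ (m ∸ a)) (proj₁ (t-large h)) ⟨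
      T₁ + (m ∸ a)           ∎
      where
      open ≡-Reasoning
      shift : ∀ r D d → r + D + d + 1 ≡ r + d + 1 + D
      shift = ℕ-Solver.solve-∀

  D : ℕ
  D = proj₁ t-gap

  t₂≡t₁+D : T₂ ≡ T₁ + D
  t₂≡t₁+D = proj₁ (proj₂ t-gap)

  D<q : D < q
  D<q = proj₂ (proj₂ t-gap)

  -- jᵢ = ⌊(k• - tᵢ)/(p + 1)⌋ + 1, computed as yᵢ / (p + 1) with yᵢ = k• + (p + 1) - tᵢ.
  y₁ y₂ j₁ j₂ : ℕ
  y₂ = κ + q ∸ T₂
  y₁ = y₂ + D
  j₁ = y₁ / q
  j₂ = y₂ / q

  y₂+t₂ : y₂ + T₂ ≡ κ + q
  y₂+t₂ = m∸n+n≡m (≤-trans t₂≤q (m≤n+m q κ))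

  y₁+t₁ : y₁ + T₁ ≡ κ + q
  y₁+t₁ = begin
    y₂ + D + T₁     ≡⟨ +-assoc y₂ D T₁ ⟩
    y₂ + (D + T₁)   ≡⟨ cong (_+_ y₂) (trans (+-comm D T₁) (sym t₂≡t₁+D)) ⟩
    y₂ + T₂         ≡⟨ y₂+t₂ ⟩
    κ + q           ∎
    where open ≡-Reasoning

  dUr≡j₁+j₂ : dUr p a s k ≡ + (j₁ + j₂)
  dUr≡j₁+j₂ = trans (cong₂ (λ f g → f ℤ.+ g ℤ.+ + 2) floor₁ floor₂) (pred+pred+2 (+ j₁) (+ j₂))
    where
    floor₁ : (+ κ ℤ.- + T₁) /ℕ q ≡ + j₁ ℤ.- + 1
    floor₁ = y+t≡x+d⇒[x-t]/ℕd≡y/d-1 q {y = y₁} y₁+t₁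
    floor₂ : (+ κ ℤ.- + T₂) /ℕ q ≡ + j₂ ℤ.- + 1
    floor₂ = y+t≡x+d⇒[x-t]/ℕd≡y/d-1 q {y = y₂} y₂+t₂
    pred+pred+2 : ∀ x y → x ℤ.- + 1 ℤ.+ (y ℤ.- + 1) ℤ.+ + 2 ≡ x ℤ.+ y
    pred+pred+2 = ℤ-Solver.solve-∀

  +k≡ : + k ≡ + 2 ℤ.+ + ρ ℤ.+ + κ ℤ.* + m
  +k≡ = trans (cong +_ k≡2+ρ+κm) (cong (λ z → + (2 + ρ) ℤ.+ z) (ℤP.pos-* κ m))

  dNew≡ : ∀ {N} → dUr p a s k ≡ N →
          dNew p a s k ≡ + 2 ℤ.* + κ ℤ.+ + 2 ℤ.- + 2 ℤ.* + δₚ ℤ.- + 2 ℤ.* N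
  dNew≡ n≡N = cong₂ (λ x n → x ℤ.- + 2 ℤ.* n)
    (cong₂ (λ u v → u ℤ.+ + 2 ℤ.- v) (ℤP.pos-* 2 κ) (ℤP.pos-* 2 δₚ)) n≡N

  +ρ≡ : + ρ ≡ + T₁ ℤ.+ + T₂ ℤ.- (+ δₚ ℤ.* (+ 2 ℤ.+ + m) ℤ.+ + 2)
  +ρ≡ = move {y = + δₚ ℤ.* (+ 2 ℤ.+ + m) ℤ.+ + 2}
    (trans (cong (λ z → + ρ ℤ.+ (z ℤ.+ + 2)) (sym (ℤP.pos-* δₚ q))) (cong +_ ρ+δq+2≡t₁+t₂))
    where
    move : ∀ {x y z} → x ℤ.+ y ≡ z → x ≡ z ℤ.- y
    move {x} {y} refl = ℤ-Solver.solve (x ∷ y ∷ [])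
    ρ+δq+2≡t₁+t₂ : ρ + (δₚ * q + 2) ≡ T₁ + T₂
    ρ+δq+2≡t₁+t₂ = begin
      ρ + (δₚ * q + 2)         ≡⟨ regroup ρ δₚ m ⟩
      ρ + δₚ * m + 2 * δₚ + 2  ≡⟨ cong (λ x → x + 2 * δₚ + 2) ρ+δm≡r+s ⟩
      r + s + 2 * δₚ + 2       ≡⟨ t₁+t₂≡r+s+2δ+2 ⟨
      T₁ + T₂                  ∎
      where
      open ≡-Reasoning
      regroup : ∀ ρ d m → ρ + (d * (2 + m) + 2) ≡ ρ + d * m + 2 * d + 2
      regroup = ℕ-Solver.solve-∀

  Inequality : Set
  Inequality = let n = dUr p a s k in
    ((toℚ (+ k) ℚ.- toℚ (+ 2)) ℚ.* ½)
      ℚ.- (((toℚ (+ m) ℚ.* ((toℚ (dNew p a s k) ℚ.* ½) ℚ.- 1ℚ)) ℚ.+ θ p a s n) ℚ.* ½)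
    ℚ.≥ ((+ m ℚ./ q) ℚ.* toℚ (+ κ)) ℚ.- (if isEven n then 1ℚ else toℚ (+ 2))

  inequality-from : ∀ T j (Θ C : ℤ) → θ p a s (dUr p a s k) ≡ toℚ Θ →
    (if isEven (dUr p a s k) then 1ℚ else toℚ (+ 2)) ≡ toℚ C →
    + 2 ℤ.* (+ k ℤ.- + 2) ℤ.- + m ℤ.* (dNew p a s k ℤ.- + 2) ℤ.- + 2 ℤ.* Θ
      ≡ + 4 ℤ.* (+ T ℤ.- + δₚ ℤ.+ + m ℤ.* + j ℤ.- C) →
    δₚ ≤ T → κ < T + j * q → Inequality
  inequality-from T j Θ C θ≡ c≡ E≡ δ≤T κ<T+jq =
    clear-denominators m k κ (T ∸ δₚ + m * j) (dNew p a s k) Θ C θ≡ c≡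
      (trans E≡ (cong (λ x → + 4 ℤ.* (x ℤ.- C)) X≡)) (scaled-floor-bound δ≤1 δ≤T κ<T+jq)
    where
    X≡ : + T ℤ.- + δₚ ℤ.+ + m ℤ.* + j ≡ + (T ∸ δₚ + m * j)
    X≡ = cong₂ ℤ._+_ (trans (ℤP.m-n≡m⊖n T δₚ) (ℤP.⊖-≥ δ≤T)) (sym (ℤP.pos-* m j))

  inequality : Inequality
  inequality with [y+D]/d≡y/d∨1+y/d q y₂ D<q
  ... | inj₁ j₁≡j₂ = inequality-from T₁ j₂ (+ T₂ ℤ.- + T₁) (+ 1)
          (trans (cong (θ p a s) n≡) (θ-even p a s j₂))
          (cong (λ b → if b then 1ℚ else toℚ (+ 2)) (trans (cong isEven n≡) (isEven-double j₂)))
          (quadrupled-lhs-even (+ m) (+ κ) (+ δₚ) (+ T₁) (+ T₂) (+ j₂) +k≡ (dNew≡ n≡) +ρ≡)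
          δ≤t₁ (subst (λ j → κ < T₁ + j * q) j₁≡j₂ (y+t≡x+d⇒x<t+[y/d]*d q {y = y₁} y₁+t₁))
    where
    n≡ : dUr p a s k ≡ + (j₂ + j₂)
    n≡ = trans dUr≡j₁+j₂ (cong (λ j → + (j + j₂)) j₁≡j₂)
  ... | inj₂ j₁≡1+j₂ = inequality-from T₂ j₂ (+ T₁ ℤ.- + T₂ ℤ.+ + q) (+ 2)
          (trans (cong (θ p a s) n≡) (θ-odd p a s j₂))
          (cong (λ b → if b then 1ℚ else toℚ (+ 2)) (trans (cong isEven n≡) (isEven-double+1 j₂)))
          (quadrupled-lhs-odd (+ m) (+ κ) (+ δₚ) (+ T₁) (+ T₂) (+ j₂) +k≡ (dNew≡ n≡) +ρ≡)
          (≤-trans δ≤t₁ (subst (T₁ ≤_) (sym t₂≡t₁+D) (m≤m+n T₁ D)))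
          (y+t≡x+d⇒x<t+[y/d]*d q {y = y₂} y₂+t₂)
    where
    n≡ : dUr p a s k ≡ + suc (j₂ + j₂)
    n≡ = trans dUr≡j₁+j₂ (cong (λ j → + (j + j₂)) j₁≡1+j₂)

lemma3p8 : (p a s k : ℕ) → Prime p → 11 ≤ p → 2 ≤ a → a ≤ p ∸ 5 → s ≤ p ∸ 2 →
    In𝒦 p a s k →
    let n = dUr p a s k in
    ((toℚ (+ k) ℚ.- toℚ (+ 2)) ℚ.* ℚ.½)
      ℚ.- (((toℚ (+ (p ∸ 1)) ℚ.* ((toℚ (dNew p a s k) ℚ.* ℚ.½) ℚ.- ℚ.1ℚ)) ℚ.+ θ p a s n) ℚ.* ℚ.½)
    ℚ.≥ ((+ (p ∸ 1) ℚ./ suc p) ℚ.* toℚ (+ k• p a s k))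
      ℚ.- (if isEven n then ℚ.1ℚ else toℚ (+ 2))
lemma3p8 zero          _ _ _ _ ()           _ _ _ _
lemma3p8 (suc zero)    _ _ _ _ (s≤s ())     _ _ _ _
lemma3p8 (suc (suc μ)) a s k _ _ _ a≤p∸5 s≤p∸2 k∈𝒦 =
  Estimate.inequality μ a s k a≤p-1 (s≤s s≤p∸2) k∈𝒦
  where
  a≤p-1 : a ≤ suc μ
  a≤p-1 = ≤-trans a≤p∸5 (≤-trans (m∸n≤m μ 3) (n≤1+n μ))
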